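{- Let $q\ge1$ and $n\ge1$. There is a bijection between the set of isotopy classes of transitive sets of $q$ mutually orthogonal Latin squares of order $n$ (equivalently, transitive elements of $(q+2)\text{ -OA}(n)$ up to isotopy) and the set of equivalence classes of group packets in $(q+2)\text{ -GP}(n)$.
   Context: A set of $q$ mutually orthogonal Latin squares (MOLS) of order $n$ is identified with an orthogonal array in $(q+2)\text{ -OA}(n)$: data $(S,X_i,\pi_i)_{i=1}^{q+2}$ with $|X_i|=n$ and maps $\pi_i\colon S\to X_i$ such that $\pi_i\times\pi_j\colon S\to X_i\times X_j$ is a bijection for all $i\neq j$ (two coordinates index rows and columns, the others give the symbols of the $q$ squares). An isotopy $(S,X_i,\pi_i)\to(S',X'_i,\pi'_i)$ is a collection of bijections $\sigma\colon S\to S'$, $\sigma_i\colon X_i\to X_i'$ with $\pi'_i\sigma=\sigma_i\pi_i$. Regarding $S\subset\prod_iX_i$ via $\prod_i\pi_i$, the autotopy group is $\mathrm{Aut}(S,X_i)=\{(\sigma_i)\in\prod_i\mathrm{Sym}(X_i):(\sigma_i)(S)=S\}$; the set of MOLS (array) is transitive if this group acts transitively on $S$. A group packet in $(q+2)\text{ -GP}(n)$ is $(G,H_i)_{i=1}^{q+2}$ with $G$ a group and $H_i\le G$ subgroups such that there is a subgroup $K$ with $H_i\cap H_j=K$ for all $i\ne j$ and $[G:H_i]=[H_i:K]=n$. An admissible morphism $(G,H_i)\to(G',H'_i)$ is a homomorphism $\alpha\colon G\to G'$ with $\alpha(H_i)\subset H'_i$ such that each induced map $G/H_i\to G'/H'_i$,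 $gH_i\mapsto\alpha(g)H'_i$, is bijective. Two group packets are equivalent if there is a third group packet and admissible morphisms from both to it. -}

module Defs where

open import Level using (0ℓ)
open import Data.Nat using (ℕ)
open import Data.Fin using (Fin)
open import Data.Product using (Σ; ∃; _×_; _,_; proj₁)
open import Relation.Binary.PropositionalEquality using (_≡_; _≢_)
open import Function.Bundles using (_↔_; Inverse)
open import Function.Definitions using (Bijective)
open import Algebra.Bundles using (Group)
open import Algebra.Morphism.Structures using (IsGroupHomomorphism)

record OA (m n : ℕ) : Set₁ where
  field
    S     : Set
    X     : Fin m → Set
    π     : (i : Fin m) → S → X i
    size  : (i : Fin m) → X i ↔ Fin n
    pairs : (i j : Fin m) → i ≢ j →
            Bijective _≡_ _≡_ (λ (s : S) → (π i s , π j s))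

open OA public

to : {A B : Set} → A ↔ B → A → B
to e = Inverse.to e

record Isotopy {m n : ℕ} (A B : OA m n) : Set where
  field
    σ    : S A ↔ S B
    σᵢ   : (i : Fin m) → X A i ↔ X B i
    comm : (i : Fin m) (s : S A) → π B i (to σ s) ≡ to (σᵢ i) (π A i s)

Isotopic : {m n : ℕ} → OA m n → OA m n → Set
Isotopic A B = Isotopy A B

-- Autotopies: tuples (σ_i) of permutations of the X_i with (σ_i)(S) = S,
-- where S is regarded as a subset of ∏ X_i via ∏ π_i.
record Autotopy {m n : ℕ} (A : OA m n) : Set where
  field
    σᵢ  : (i : Fin m) → X A i ↔ X A i
    fwd : (s : S A) → ∃ λ (s' : S A) → (i : Fin m) → π A i s' ≡ to (σᵢ i) (π A i s)
    bwd : (s' : S A) → ∃ λ (s : S A) → (i : Fin m) → π A i s' ≡ to (σᵢ i) (π A i s)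

open Autotopy public

Transitive : {m n : ℕ} → OA m n → Set
Transitive {m} A = (s t : S A) →
  Σ (Autotopy A) λ a → (i : Fin m) → π A i t ≡ to (σᵢ a i) (π A i s)

TOA : ℕ → ℕ → Set₁
TOA m n = Σ (OA m n) Transitive

IsotopicT : {m n : ℕ} → TOA m n → TOA m n → Set
IsotopicT (A , _) (B , _) = Isotopic A B

Grp : Set₁
Grp = Group 0ℓ 0ℓ

Car : Grp → Set
Car G = Group.Carrier G

record IsSubgroup (G : Grp) (H : Car G → Set) : Set where
  open Group G
  field
    resp : ∀ {x y} → x ≈ y → H x → H y
    ε∈   : H ε
    ∙∈   : ∀ {x y} → H x → H y → H (x ∙ y)
    ⁻¹∈  : ∀ {x} → H x → H (x ⁻¹)

-- [G : H] = n : there is a bijection G/H ≅ Fin n, given as a surjection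
-- f : G → Fin n whose fibres are exactly the left cosets gH
-- (gH = hH ⇔ g⁻¹h ∈ H).
HasIndex : (G : Grp) → (Car G → Set) → ℕ → Set
HasIndex G H n =
  Σ (Car G → Fin n) λ f →
    ((k : Fin n) → ∃ λ x → f x ≡ k) ×
    ((x y : Car G) → (f x ≡ f y → H (x ⁻¹ ∙ y)) × (H (x ⁻¹ ∙ y) → f x ≡ f y))
  where open Group G

HasRelIndex : (G : Grp) → (Car G → Set) → (Car G → Set) → ℕ → Set
HasRelIndex G H K n =
  Σ (Σ (Car G) H → Fin n) λ f →
    ((k : Fin n) → ∃ λ x → f x ≡ k) ×
    ((x y : Σ (Car G) H) →
       (f x ≡ f y → K (proj₁ x ⁻¹ ∙ proj₁ y)) × (K (proj₁ x ⁻¹ ∙ proj₁ y) → f x ≡ f y))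
  where open Group G

record GroupPacket (m n : ℕ) : Set₁ where
  field
    G      : Grp
    H      : Fin m → Car G → Set
    H-sub  : (i : Fin m) → IsSubgroup G (H i)
    K      : Car G → Set
    K-sub  : IsSubgroup G K
    inter  : (i j : Fin m) → i ≢ j → (x : Car G) →
             ((H i x × H j x) → K x) × (K x → (H i x × H j x))
    index  : (i : Fin m) → HasIndex G (H i) n
    rindex : (i : Fin m) → HasRelIndex G (H i) K n

record Admissible {m n : ℕ} (P P' : GroupPacket m n) : Set where
  module P  = GroupPacket P
  module P' = GroupPacket P'
  module G  = Group P.G
  module G' = Group P'.G
  field
    α    : Car P.G → Car P'.G
    hom  : IsGroupHomomorphism G.rawGroup G'.rawGroup α
    maps : (i : Fin m) (x : Car P.G) → P.H i x → P'.H i (α x)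
    -- the induced map G/H_i → G'/H'_i, gH_i ↦ α(g)H'_i, is injective ...
    inj  : (i : Fin m) (x y : Car P.G) →
           P'.H i (α x G'.⁻¹ G'.∙ α y) → P.H i (x G.⁻¹ G.∙ y)
    -- ... and surjective
    surj : (i : Fin m) (y : Car P'.G) →
           ∃ λ (x : Car P.G) → P'.H i (α x G'.⁻¹ G'.∙ y)

GPEquiv : {m n : ℕ} → GroupPacket m n → GroupPacket m n → Set₁
GPEquiv {m} {n} P P' =
  Σ (GroupPacket m n) λ P'' → Admissible P P'' × Admissible P' P''

{-# OPTIONS --safe #-}
-- Φ sends a transitive array A with a base point s₀ to its autotopy group with the
-- stabilisers of the coordinates of s₀.  Transitivity makes every X i a single orbit,
-- so the stabilisers have index n, and a point is determined by two of its coordinates,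
-- so any two stabilisers meet in the stabiliser of s₀.  Ψ sends a packet to the array
-- of pairs of cosets of H₀ and H₁, read off in every coordinate through a group element
-- realising them; G acts on it transitively by left translation.  An isotopy conjugates
-- autotopy groups, an admissible morphism induces bijections of cosets, Ψ (Φ A) ≅ A by
-- sending s to an autotopy moving s₀ to s, and left translation G → Aut (Ψ P) is an
-- admissible morphism.
module Submission where

open import Defs
open import Data.Nat using (ℕ; zero; suc; _+_; _≤_)
open import Data.Nat.Properties using (+-comm; 1+n≰n)
open import Data.Fin using (Fin; zero; suc; punchOut)
open import Data.Fin.Properties using (any?; punchOut-injective; injective⇒≤; 0≢1+n) renaming (_≟_ to _≟ᶠ_)
open import Data.Product using (Σ; ∃; _×_; _,_; proj₁; proj₂)
open import Relation.Binary.PropositionalEquality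
  using (_≡_; _≢_; refl; sym; trans; cong; cong₂; subst; module ≡-Reasoning)
open import Relation.Nullary using (yes; no; contradiction)
open import Function.Base using (_∘_)
open import Function.Bundles using (_↔_; Inverse; mk↔ₛ′; _⇔_; mk⇔; Equivalence; Injection)
open import Function.Definitions using (Injective; Bijective)
open import Function.Construct.Composition using (_⇔-∘_)
open import Function.Properties.Inverse using (↔-refl; ↔-sym; ↔-trans; ↔⇒↣)
open import Algebra.Bundles using (Group)
open import Algebra.Structures using (IsGroup)
open import Relation.Binary.Structures using (IsEquivalence)
open import Algebra.Morphism.Structures using (IsGroupHomomorphism)
import Algebra.Properties.Group as GroupProperties
import Relation.Binary.Reasoning.Setoid as SetoidReasoning

open Inverse using (from; strictlyInverseˡ; strictlyInverseʳ)

private variable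
  k n : ℕ

injective⇒surjective : (f : Fin n → Fin n) → Injective _≡_ _≡_ f → ∀ y → ∃ λ x → f x ≡ y
injective⇒surjective {zero}  f f-inj ()
injective⇒surjective {suc n} f f-inj y with any? (λ x → f x ≟ᶠ y)
... | yes hit = hit
... | no miss = contradiction (injective⇒≤ f′-inj) 1+n≰n
  where
  f′ : Fin (suc n) → Fin n
  f′ x = punchOut {i = y} (miss ∘ (x ,_) ∘ sym)
  f′-inj : Injective _≡_ _≡_ f′
  f′-inj {x} {x′} = f-inj ∘ punchOut-injective {i = y} (miss ∘ (x ,_) ∘ sym) (miss ∘ (x′ ,_) ∘ sym)

injective⇒↔ : (f : Fin n → Fin n) → Injective _≡_ _≡_ f → Fin n ↔ Fin n
injective⇒↔ f f-inj = mk↔ₛ′ f f⁻¹ (proj₂ ∘ surj) (λ x → f-inj (proj₂ (surj (f x))))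
  where
  surj = injective⇒surjective f f-inj
  f⁻¹ = proj₁ ∘ surj

to-injective : {A B : Set} (e : A ↔ B) → Injective _≡_ _≡_ (to e)
to-injective e = Injection.injective (↔⇒↣ e)

other : Fin (suc (suc k)) → Fin (suc (suc k))
other zero    = suc zero
other (suc _) = zero

≢other : (i : Fin (suc (suc k))) → i ≢ other i
≢other zero    = 0≢1+n
≢other (suc i) = 0≢1+n ∘ sym

0≢1 : _≢_ {A = Fin (suc (suc k))} zero (suc zero)
0≢1 = 0≢1+n

module OrthogonalArray {m : ℕ} (A : OA m n) where

  pair-injective : ∀ {i j} → i ≢ j → ∀ {s s′} → π A i s ≡ π A i s′ → π A j s ≡ π A j s′ → s ≡ s′
  pair-injective {i} {j} i≢j eᵢ eⱼ = proj₁ (pairs A i j i≢j) (cong₂ _,_ eᵢ eⱼ)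

  pair-surjective : ∀ {i j} → i ≢ j → (u : X A i) (v : X A j) → ∃ λ s → π A i s ≡ u × π A j s ≡ v
  pair-surjective {i} {j} i≢j u v = s , cong proj₁ πs≡uv , cong proj₂ πs≡uv
    where
    s = proj₁ (proj₂ (pairs A i j i≢j) (u , v))
    πs≡uv = proj₂ (proj₂ (pairs A i j i≢j) (u , v)) refl

  act : Autotopy A → S A → S A
  act a s = proj₁ (fwd a s)

  π-act : ∀ (a : Autotopy A) i s → π A i (act a s) ≡ to (σᵢ a i) (π A i s)
  π-act a i s = proj₂ (fwd a s) i

open OrthogonalArray

module _ {m : ℕ} where

  isotopy-refl : {A : OA m n} → Isotopy A A
  isotopy-refl = record { σ = ↔-refl ; σᵢ = λ _ → ↔-refl ; comm = λ _ _ → refl }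

  isotopy-sym : {A B : OA m n} → Isotopy A B → Isotopy B A
  isotopy-sym {A = A} {B} ι = record { σ = ↔-sym I.σ ; σᵢ = ↔-sym ∘ I.σᵢ ; comm = comm }
    where
    module I = Isotopy ι
    comm : ∀ i s → π A i (from I.σ s) ≡ from (I.σᵢ i) (π B i s)
    comm i s = begin
      π A i (from I.σ s)                              ≡⟨ strictlyInverseʳ (I.σᵢ i) _ ⟨
      from (I.σᵢ i) (to (I.σᵢ i) (π A i (from I.σ s))) ≡⟨ cong (from (I.σᵢ i)) (I.comm i (from I.σ s)) ⟨
      from (I.σᵢ i) (π B i (to I.σ (from I.σ s)))      ≡⟨ cong (from (I.σᵢ i) ∘ π B i) (strictlyInverseˡ I.σ s) ⟩
      from (I.σᵢ i) (π B i s)                          ∎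
      where open ≡-Reasoning

  isotopy-trans : {A B C : OA m n} → Isotopy A B → Isotopy B C → Isotopy A C
  isotopy-trans ι κ = record
    { σ    = ↔-trans I.σ K.σ
    ; σᵢ   = λ i → ↔-trans (I.σᵢ i) (K.σᵢ i)
    ; comm = λ i s → trans (K.comm i _) (cong (to (K.σᵢ i)) (I.comm i s))
    }
    where
    module I = Isotopy ι
    module K = Isotopy κ

  isotopy⇒autotopy : {A : OA m n} → Isotopy A A → Autotopy A
  isotopy⇒autotopy {A = A} ι = record
    { σᵢ  = I.σᵢ
    ; fwd = λ s → to I.σ s , λ i → I.comm i s
    ; bwd = λ s → from I.σ s , λ i → trans (cong (π A i) (sym (strictlyInverseˡ I.σ s))) (I.comm i (from I.σ s))
    }
    where module I = Isotopy ι

-- Points are determined by two coordinates, so a map of points compatible with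
-- bijections of the coordinate sets is itself a bijection.
mkIsotopy : {A B : OA (suc (suc k)) n} (h : S A → S B) (σ : ∀ i → X A i ↔ X B i) →
            (∀ i s → π B i (h s) ≡ to (σ i) (π A i s)) → Isotopy A B
mkIsotopy {A = A} {B} h σ comm = record { σ = mk↔ₛ′ h h⁻¹ h∘h⁻¹ h⁻¹∘h ; σᵢ = σ ; comm = comm }
  where
  preimage : (t : S B) → ∃ λ s → π A zero s ≡ from (σ zero) (π B zero t)
                               × π A (suc zero) s ≡ from (σ (suc zero)) (π B (suc zero) t)
  preimage t = pair-surjective A 0≢1 _ _

  h⁻¹ : S B → S A
  h⁻¹ = proj₁ ∘ preimage

  h∘h⁻¹ : ∀ t → h (h⁻¹ t) ≡ t
  h∘h⁻¹ t = pair-injective B 0≢1 (restore zero (proj₁ eqs)) (restore (suc zero) (proj₂ eqs))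
    where
    eqs = proj₂ (preimage t)
    restore : ∀ i → π A i (h⁻¹ t) ≡ from (σ i) (π B i t) → π B i (h (h⁻¹ t)) ≡ π B i t
    restore i e = trans (comm i _) (trans (cong (to (σ i)) e) (strictlyInverseˡ (σ i) _))

  h⁻¹∘h : ∀ s → h⁻¹ (h s) ≡ s
  h⁻¹∘h s = pair-injective A 0≢1 (restore zero (proj₁ eqs)) (restore (suc zero) (proj₂ eqs))
    where
    eqs = proj₂ (preimage (h s))
    restore : ∀ i → π A i (h⁻¹ (h s)) ≡ from (σ i) (π B i (h s)) → π A i (h⁻¹ (h s)) ≡ π A i s
    restore i e = trans e (trans (cong (from (σ i)) (comm i s)) (strictlyInverseʳ (σ i) _))

autotopy⇒isotopy : {A : OA (suc (suc k)) n} → Autotopy A → Isotopy A A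
autotopy⇒isotopy {A = A} a = mkIsotopy (act A a) (σᵢ a) (π-act A a)

module _ {A : OA (suc (suc k)) n} where

  infix  4 _≈ᵃ_
  infixl 7 _∘ᵃ_

  _≈ᵃ_ : Autotopy A → Autotopy A → Set
  a ≈ᵃ b = ∀ i y → to (σᵢ a i) y ≡ to (σᵢ b i) y

  _∘ᵃ_ : Autotopy A → Autotopy A → Autotopy A
  a ∘ᵃ b = isotopy⇒autotopy (isotopy-trans (autotopy⇒isotopy b) (autotopy⇒isotopy a))

  idᵃ : Autotopy A
  idᵃ = isotopy⇒autotopy isotopy-refl

  _⁻¹ᵃ : Autotopy A → Autotopy A
  a ⁻¹ᵃ = isotopy⇒autotopy (isotopy-sym (autotopy⇒isotopy a))

  ≈ᵃ-isEquivalence : IsEquivalence _≈ᵃ_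
  ≈ᵃ-isEquivalence = record
    { refl  = λ _ _ → refl
    ; sym   = λ a≈b i y → sym (a≈b i y)
    ; trans = λ a≈b b≈c i y → trans (a≈b i y) (b≈c i y)
    }

  autotopy-isGroup : IsGroup _≈ᵃ_ _∘ᵃ_ idᵃ _⁻¹ᵃ
  autotopy-isGroup = record
    { isMonoid = record
      { isSemigroup = record
        { isMagma = record
          { isEquivalence = ≈ᵃ-isEquivalence
          ; ∙-cong = λ {a} a≈a′ b≈b′ i y → trans (cong (to (σᵢ a i)) (b≈b′ i y)) (a≈a′ i _)
          }
        ; assoc = λ _ _ _ _ _ → refl
        }
      ; identity = (λ _ _ _ → refl) , (λ _ _ _ → refl)
      }
    ; inverse = (λ a i → strictlyInverseʳ (σᵢ a i)) , (λ a i → strictlyInverseˡ (σᵢ a i))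
    ; ⁻¹-cong = λ {a} {b} a≈b i y → begin
        from (σᵢ a i) y                               ≡⟨ strictlyInverseʳ (σᵢ b i) _ ⟨
        from (σᵢ b i) (to (σᵢ b i) (from (σᵢ a i) y)) ≡⟨ cong (from (σᵢ b i)) (a≈b i _) ⟨
        from (σᵢ b i) (to (σᵢ a i) (from (σᵢ a i) y)) ≡⟨ cong (from (σᵢ b i)) (strictlyInverseˡ (σᵢ a i) y) ⟩
        from (σᵢ b i) y                               ∎
    }
    where open ≡-Reasoning

  Fixes : ∀ i → X A i → Autotopy A → Set
  Fixes i y a = to (σᵢ a i) y ≡ y

  sameImage⇔fixes : ∀ {i y} a b → (to (σᵢ a i) y ≡ to (σᵢ b i) y) ⇔ Fixes i y (a ⁻¹ᵃ ∘ᵃ b)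
  sameImage⇔fixes {i} {y} a b = mk⇔
    (λ ay≡by → trans (cong (from (σᵢ a i)) (sym ay≡by)) (strictlyInverseʳ (σᵢ a i) y))
    (λ fixes → trans (cong (to (σᵢ a i)) (sym fixes)) (strictlyInverseˡ (σᵢ a i) _))

autotopyGroup : OA (suc (suc k)) n → Grp
autotopyGroup A .Group.Carrier = Autotopy A
autotopyGroup A .Group._≈_     = _≈ᵃ_
autotopyGroup A .Group._∙_     = _∘ᵃ_
autotopyGroup A .Group.ε       = idᵃ
autotopyGroup A .Group._⁻¹     = _⁻¹ᵃ
autotopyGroup A .Group.isGroup = autotopy-isGroup

fixes-isSubgroup : {A : OA (suc (suc k)) n} (i : Fin (suc (suc k))) (y : X A i) → IsSubgroup (autotopyGroup A) (Fixes i y)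
fixes-isSubgroup i y = record
  { resp = λ a≈b a-fixes → trans (sym (a≈b i y)) a-fixes
  ; ε∈   = refl
  ; ∙∈   = λ {a} a-fixes b-fixes → trans (cong (to (σᵢ a i)) b-fixes) a-fixes
  ; ⁻¹∈  = λ {a} a-fixes → trans (cong (from (σᵢ a i)) (sym a-fixes)) (strictlyInverseʳ (σᵢ a i) y)
  }

⋂-isSubgroup : {G : Grp} {I : Set} {H : I → Car G → Set} →
               (∀ l → IsSubgroup G (H l)) → IsSubgroup G (λ x → ∀ l → H l x)
⋂-isSubgroup H-sub = record
  { resp = λ x≈y x∈H l → resp (H-sub l) x≈y (x∈H l)
  ; ε∈   = λ l → ε∈ (H-sub l)
  ; ∙∈   = λ x∈H y∈H l → ∙∈ (H-sub l) (x∈H l) (y∈H l)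
  ; ⁻¹∈  = λ x∈H l → ⁻¹∈ (H-sub l) (x∈H l)
  }
  where open IsSubgroup

module CosetLabels (P : GroupPacket (suc (suc k)) n) where
  open GroupPacket P public
  open Group G public renaming (refl to ≈-refl; sym to ≈-sym; trans to ≈-trans)
  open GroupProperties G using (ε⁻¹≈ε; ⁻¹-anti-homo-∙; \\-leftDividesˡ; \\-leftDividesʳ)

  label : ∀ i → Carrier → Fin n
  label i = proj₁ (index i)

  rep : ∀ i → Fin n → Carrier
  rep i t = proj₁ (proj₁ (proj₂ (index i)) t)

  label-rep : ∀ i t → label i (rep i t) ≡ t
  label-rep i t = proj₂ (proj₁ (proj₂ (index i)) t)

  label≡⇒H : ∀ i {x y} → label i x ≡ label i y → H i (x ⁻¹ ∙ y)
  label≡⇒H i {x} {y} = proj₁ (proj₂ (proj₂ (index i)) x y)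

  H⇒label≡ : ∀ i {x y} → H i (x ⁻¹ ∙ y) → label i x ≡ label i y
  H⇒label≡ i {x} {y} = proj₂ (proj₂ (proj₂ (index i)) x y)

  label-cong : ∀ i {x y} → x ≈ y → label i x ≡ label i y
  label-cong i {x} x≈y = H⇒label≡ i (IsSubgroup.resp (H-sub i) x⁻¹x≈x⁻¹y (IsSubgroup.ε∈ (H-sub i)))
    where x⁻¹x≈x⁻¹y = ≈-trans (≈-sym (inverseˡ x)) (∙-congˡ x≈y)

  label-∙ˡ : ∀ i x {y z} → label i y ≡ label i z → label i (x ∙ y) ≡ label i (x ∙ z)
  label-∙ˡ i x {y} {z} ly≡lz = H⇒label≡ i (IsSubgroup.resp (H-sub i) (≈-sym cancel) (label≡⇒H i ly≡lz))
    where
    open SetoidReasoning setoid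
    cancel : (x ∙ y) ⁻¹ ∙ (x ∙ z) ≈ y ⁻¹ ∙ z
    cancel = begin
      (x ∙ y) ⁻¹ ∙ (x ∙ z)      ≈⟨ ∙-congʳ (⁻¹-anti-homo-∙ x y) ⟩
      (y ⁻¹ ∙ x ⁻¹) ∙ (x ∙ z)   ≈⟨ assoc _ _ _ ⟩
      y ⁻¹ ∙ (x ⁻¹ ∙ (x ∙ z))   ≈⟨ ∙-congˡ (\\-leftDividesʳ x z) ⟩
      y ⁻¹ ∙ z                  ∎

  label-∙-rep : ∀ i x y → label i (x ∙ rep i (label i y)) ≡ label i (x ∙ y)
  label-∙-rep i x y = label-∙ˡ i x (label-rep i (label i y))

  H⇔label≡label-ε : ∀ i {h} → H i h ⇔ (label i h ≡ label i ε)
  H⇔label≡label-ε i {h} = mk⇔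
    (λ h∈H → sym (H⇒label≡ i (IsSubgroup.resp (H-sub i) (≈-sym ε⁻¹h≈h) h∈H)))
    (λ lh≡lε → IsSubgroup.resp (H-sub i) ε⁻¹h≈h (label≡⇒H i (sym lh≡lε)))
    where ε⁻¹h≈h = ≈-trans (∙-congʳ ε⁻¹≈ε) (identityˡ h)

  K⊆H : ∀ i {x} → K x → H i x
  K⊆H i {x} = proj₁ ∘ proj₂ (inter i (other i) (≢other i) x)

  labels-determined : ∀ {i j} → i ≢ j → ∀ {x y} → label i x ≡ label i y → label j x ≡ label j y →
                      ∀ l → label l x ≡ label l y
  labels-determined {i} {j} i≢j lᵢ lⱼ l =
    H⇒label≡ l (K⊆H l (proj₁ (inter i j i≢j _) (label≡⇒H i lᵢ , label≡⇒H j lⱼ)))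

  -- H i / K has n elements and injects into G / H j because H i ∩ H j = K,
  -- so it meets every left coset of H j.
  labels-realisable : ∀ {i j} → i ≢ j → ∀ a b → ∃ λ g → label i g ≡ a × label j g ≡ b
  labels-realisable {i} {j} i≢j a b = x ∙ h , label-i , label-j
    where
    relLabel = proj₁ (rindex i)
    transversal : Fin n → Σ Carrier (H i)
    transversal t = proj₁ (proj₁ (proj₂ (rindex i)) t)
    relLabel-transversal : ∀ t → relLabel (transversal t) ≡ t
    relLabel-transversal t = proj₂ (proj₁ (proj₂ (rindex i)) t)
    relLabel≡ : ∀ h h′ → K (proj₁ h ⁻¹ ∙ proj₁ h′) → relLabel h ≡ relLabel h′
    relLabel≡ h h′ = proj₂ (proj₂ (proj₂ (rindex i)) h h′)

    labelⱼ-transversal : Fin n → Fin n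
    labelⱼ-transversal t = label j (proj₁ (transversal t))
    labelⱼ-transversal-injective : Injective _≡_ _≡_ labelⱼ-transversal
    labelⱼ-transversal-injective {t} {t′} e = begin
      t                           ≡⟨ relLabel-transversal t ⟨
      relLabel (transversal t)    ≡⟨ relLabel≡ (transversal t) (transversal t′) h⁻¹h′∈K ⟩
      relLabel (transversal t′)   ≡⟨ relLabel-transversal t′ ⟩
      t′                          ∎
      where
      open ≡-Reasoning
      open IsSubgroup (H-sub i) using (∙∈; ⁻¹∈)
      h⁻¹h′∈Hᵢ = ∙∈ (⁻¹∈ (proj₂ (transversal t))) (proj₂ (transversal t′))
      h⁻¹h′∈K = proj₁ (inter i j i≢j _) (h⁻¹h′∈Hᵢ , label≡⇒H j e)

    x = rep i a
    y = rep j b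
    hit = injective⇒surjective labelⱼ-transversal labelⱼ-transversal-injective (label j (x ⁻¹ ∙ y))
    h = proj₁ (transversal (proj₁ hit))

    label-i : label i (x ∙ h) ≡ a
    label-i = trans (label-∙ˡ i x (Equivalence.to (H⇔label≡label-ε i) (proj₂ (transversal (proj₁ hit)))))
                    (trans (label-cong i (identityʳ x)) (label-rep i a))
    label-j : label j (x ∙ h) ≡ b
    label-j = trans (label-∙ˡ j x (proj₂ hit)) (trans (label-cong j (\\-leftDividesˡ x y)) (label-rep j b))

module PacketMorphisms (P Q : GroupPacket (suc (suc k)) n) where
  private
    module P = CosetLabels P
    module Q = CosetLabels Q

  hom-\\ : ∀ {α} → IsGroupHomomorphism P.rawGroup Q.rawGroup α →
           ∀ x y → α (x P.⁻¹ P.∙ y) Q.≈ α x Q.⁻¹ Q.∙ α y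
  hom-\\ α-hom x y = Q.≈-trans (homo (x P.⁻¹) y) (Q.∙-congʳ (⁻¹-homo x))
    where open IsGroupHomomorphism α-hom using (homo; ⁻¹-homo)

  module InducedMaps (α : P.Carrier → Q.Carrier) (α-hom : IsGroupHomomorphism P.rawGroup Q.rawGroup α)
             (maps : ∀ i x → P.H i x → Q.H i (α x))
             (inj : ∀ i x y → Q.H i (α x Q.⁻¹ Q.∙ α y) → P.H i (x P.⁻¹ P.∙ y)) where

    α-label-cong : ∀ i {x y} → P.label i x ≡ P.label i y → Q.label i (α x) ≡ Q.label i (α y)
    α-label-cong i {x} {y} e =
      Q.H⇒label≡ i (IsSubgroup.resp (Q.H-sub i) (hom-\\ α-hom x y) (maps i _ (P.label≡⇒H i e)))

    α-label-injective : ∀ i {x y} → Q.label i (α x) ≡ Q.label i (α y) → P.label i x ≡ P.label i y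
    α-label-injective i {x} {y} e = P.H⇒label≡ i (inj i x y (Q.label≡⇒H i e))

    inducedMap : ∀ i → Fin n ↔ Fin n
    inducedMap i = injective⇒↔ (λ t → Q.label i (α (P.rep i t))) λ {t} {t′} e → begin
      t                         ≡⟨ P.label-rep i t ⟨
      P.label i (P.rep i t)     ≡⟨ α-label-injective i e ⟩
      P.label i (P.rep i t′)    ≡⟨ P.label-rep i t′ ⟩
      t′                        ∎
      where open ≡-Reasoning

    inducedMap-label : ∀ i x → Q.label i (α x) ≡ to (inducedMap i) (P.label i x)
    inducedMap-label i x = α-label-cong i (sym (P.label-rep i (P.label i x)))

    inducedMap-surjective : ∀ i y → ∃ λ x → Q.H i (α x Q.⁻¹ Q.∙ y)
    inducedMap-surjective i y = P.rep i t , Q.label≡⇒H i (strictlyInverseˡ (inducedMap i) (Q.label i y))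
      where t = from (inducedMap i) (Q.label i y)

  -- Surjectivity of the induced maps G/H i → G′/H′ i is automatic: both sides have n elements.
  mkAdmissible : (α : P.Carrier → Q.Carrier) → IsGroupHomomorphism P.rawGroup Q.rawGroup α →
                 (∀ i x → P.H i x ⇔ Q.H i (α x)) → Admissible P Q
  mkAdmissible α α-hom preimage = record
    { α    = α
    ; hom  = α-hom
    ; maps = maps
    ; inj  = inj
    ; surj = InducedMaps.inducedMap-surjective α α-hom maps inj
    }
    where
    maps : ∀ i x → P.H i x → Q.H i (α x)
    maps i x = Equivalence.to (preimage i x)
    inj : ∀ i x y → Q.H i (α x Q.⁻¹ Q.∙ α y) → P.H i (x P.⁻¹ P.∙ y)
    inj i x y h = Equivalence.from (preimage i _)
      (IsSubgroup.resp (Q.H-sub i) (Q.≈-sym (hom-\\ α-hom x y)) h)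

module StabiliserPacket (A : OA (suc (suc k)) n) (transitive : Transitive A) (s₀ : S A) where
  x : ∀ i → X A i
  x i = π A i s₀

  Stabiliser : ∀ i → Autotopy A → Set
  Stabiliser i = Fixes i (x i)

  PointStabiliser : Autotopy A → Set
  PointStabiliser a = ∀ l → Stabiliser l a

  transitive-on-pairs : ∀ {i j} → i ≢ j → (u : X A i) (v : X A j) →
          ∃ λ a → to (σᵢ a i) (x i) ≡ u × to (σᵢ a j) (x j) ≡ v
  transitive-on-pairs {i} {j} i≢j u v = a , trans (sym (a-moves i)) πᵢs≡u , trans (sym (a-moves j)) πⱼs≡v
    where
    s = proj₁ (pair-surjective A i≢j u v)
    πᵢs≡u = proj₁ (proj₂ (pair-surjective A i≢j u v))
    πⱼs≡v = proj₂ (proj₂ (pair-surjective A i≢j u v))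
    a = proj₁ (transitive s₀ s)
    a-moves = proj₂ (transitive s₀ s)

  stabilisers-meet : ∀ {i j} → i ≢ j → ∀ {a} → Stabiliser i a → Stabiliser j a → PointStabiliser a
  stabilisers-meet {i} {j} i≢j {a} fixesᵢ fixesⱼ l = begin
    to (σᵢ a l) (π A l s₀)  ≡⟨ π-act A a l s₀ ⟨
    π A l (act A a s₀)      ≡⟨ cong (π A l) fixes-s₀ ⟩
    π A l s₀                ∎
    where
    open ≡-Reasoning
    fixes-s₀ : act A a s₀ ≡ s₀
    fixes-s₀ = pair-injective A i≢j (trans (π-act A a i s₀) fixesᵢ) (trans (π-act A a j s₀) fixesⱼ)

  label : ∀ i → Autotopy A → Fin n
  label i a = to (size A i) (to (σᵢ a i) (x i))

  label≡⇔stabiliser : ∀ i a b → (label i a ≡ label i b) ⇔ Stabiliser i (a ⁻¹ᵃ ∘ᵃ b)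
  label≡⇔stabiliser i a b = mk⇔
    (Equivalence.to (sameImage⇔fixes a b) ∘ to-injective (size A i))
    (cong (to (size A i)) ∘ Equivalence.from (sameImage⇔fixes a b))

  index : ∀ i → HasIndex (autotopyGroup A) (Stabiliser i) n
  index i = label i , surjective , λ a b → Equivalence.to (label≡⇔stabiliser i a b)
                                         , Equivalence.from (label≡⇔stabiliser i a b)
    where
    surjective : ∀ t → ∃ λ a → label i a ≡ t
    surjective t = a , trans (cong (to (size A i)) a-moves) (strictlyInverseˡ (size A i) t)
      where
      a = proj₁ (transitive-on-pairs (≢other i) (from (size A i) t) (x (other i)))
      a-moves = proj₁ (proj₂ (transitive-on-pairs (≢other i) (from (size A i) t) (x (other i))))

  relIndex : ∀ i → HasRelIndex (autotopyGroup A) (Stabiliser i) PointStabiliser n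
  relIndex i = label j ∘ proj₁ , surjective , λ (a , a∈Hᵢ) (b , b∈Hᵢ) →
      (λ lⱼa≡lⱼb → stabilisers-meet (≢other i) {a ⁻¹ᵃ ∘ᵃ b} (a⁻¹b∈Hᵢ {a} {b} a∈Hᵢ b∈Hᵢ)
                     (Equivalence.to (label≡⇔stabiliser j a b) lⱼa≡lⱼb))
    , (λ a⁻¹b∈K → Equivalence.from (label≡⇔stabiliser j a b) (a⁻¹b∈K j))
    where
    j = other i
    open IsSubgroup (fixes-isSubgroup {A = A} i (x i)) using (∙∈; ⁻¹∈)
    a⁻¹b∈Hᵢ : ∀ {a b} → Stabiliser i a → Stabiliser i b → Stabiliser i (a ⁻¹ᵃ ∘ᵃ b)
    a⁻¹b∈Hᵢ {a} {b} a∈Hᵢ b∈Hᵢ = ∙∈ {a ⁻¹ᵃ} {b} (⁻¹∈ {a} a∈Hᵢ) b∈Hᵢ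
    surjective : ∀ t → ∃ λ (a : Σ (Autotopy A) (Stabiliser i)) → label j (proj₁ a) ≡ t
    surjective t = (a , a-fixes) , trans (cong (to (size A j)) a-moves) (strictlyInverseˡ (size A j) t)
      where
      a = proj₁ (transitive-on-pairs (≢other i) (x i) (from (size A j) t))
      a-fixes = proj₁ (proj₂ (transitive-on-pairs (≢other i) (x i) (from (size A j) t)))
      a-moves = proj₂ (proj₂ (transitive-on-pairs (≢other i) (x i) (from (size A j) t)))

  packet : GroupPacket (suc (suc k)) n
  packet .GroupPacket.G      = autotopyGroup A
  packet .GroupPacket.H      = Stabiliser
  packet .GroupPacket.H-sub i = fixes-isSubgroup i (x i)
  packet .GroupPacket.K      = PointStabiliser
  packet .GroupPacket.K-sub  = ⋂-isSubgroup (λ l → fixes-isSubgroup l (x l))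
  packet .GroupPacket.inter i j i≢j a =
    (λ (fixesᵢ , fixesⱼ) → stabilisers-meet i≢j {a} fixesᵢ fixesⱼ) , (λ fixes → fixes i , fixes j)
  packet .GroupPacket.index  = index
  packet .GroupPacket.rindex = relIndex

module Conjugation {A B : OA (suc (suc k)) n} (ι : Isotopy A B) where
  private
    module I = Isotopy ι

  conjugate : Autotopy A → Autotopy B
  conjugate a = isotopy⇒autotopy (isotopy-trans (isotopy-sym ι) (isotopy-trans (autotopy⇒isotopy a) ι))

  conjugate-hom : IsGroupHomomorphism (Group.rawGroup (autotopyGroup A)) (Group.rawGroup (autotopyGroup B)) conjugate
  conjugate-hom = record
    { isMonoidHomomorphism = record
      { isMagmaHomomorphism = record
        { isRelHomomorphism = record { cong = λ a≈b i y → cong (to (I.σᵢ i)) (a≈b i _) }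
        ; homo = λ a b i y → cong (to (I.σᵢ i) ∘ to (σᵢ a i)) (sym (strictlyInverseʳ (I.σᵢ i) _))
        }
      ; ε-homo = λ i → strictlyInverseˡ (I.σᵢ i)
      }
    ; ⁻¹-homo = λ _ _ _ → refl
    }

  conjugate-fixes⇔ : ∀ a i y → Fixes i y a ⇔ Fixes i (to (I.σᵢ i) y) (conjugate a)
  conjugate-fixes⇔ a i y = mk⇔
    (λ fixes → trans conjugate-ι (cong (to (I.σᵢ i)) fixes))
    (λ fixes → to-injective (I.σᵢ i) (trans (sym conjugate-ι) fixes))
    where
    conjugate-ι : to (σᵢ (conjugate a) i) (to (I.σᵢ i) y) ≡ to (I.σᵢ i) (to (σᵢ a i) y)
    conjugate-ι = cong (to (I.σᵢ i) ∘ to (σᵢ a i)) (strictlyInverseʳ (I.σᵢ i) y)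

isotopy⇒admissible : {A B : OA (suc (suc k)) n} (trA : Transitive A) (trB : Transitive B) →
  Isotopy A B → ∀ s t → Admissible (StabiliserPacket.packet A trA s) (StabiliserPacket.packet B trB t)
isotopy⇒admissible {A = A} {B} trA trB ι s t = mkAdmissible conjugate conjugate-hom preimage
  where
  open PacketMorphisms (StabiliserPacket.packet A trA s) (StabiliserPacket.packet B trB t) using (mkAdmissible)
  -- conjugate by ι, followed by an autotopy τ of B moving the image of s to t
  τ = proj₁ (trB (to (Isotopy.σ ι) s) t)
  ι′ = isotopy-trans ι (autotopy⇒isotopy τ)
  open Conjugation ι′
  transported : ∀ i → π B i t ≡ to (Isotopy.σᵢ ι′ i) (π A i s)
  transported i = trans (proj₂ (trB (to (Isotopy.σ ι) s) t) i) (cong (to (σᵢ τ i)) (Isotopy.comm ι i s))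
  preimage : ∀ i a → Fixes i (π A i s) a ⇔ Fixes i (π B i t) (conjugate a)
  preimage i a rewrite transported i = conjugate-fixes⇔ a i (π A i s)

module CosetArray (P : GroupPacket (suc (suc k)) n) where
  open CosetLabels P
  open GroupProperties G using (\\-leftDividesˡ; \\-leftDividesʳ; //-rightDividesˡ)

  Point : Set
  Point = Fin n × Fin n

  element : Point → Carrier
  element (a , b) = proj₁ (labels-realisable 0≢1 a b)

  coordinate : ∀ i → Point → Fin n
  coordinate i = label i ∘ element

  pointOf : Carrier → Point
  pointOf g = label zero g , label (suc zero) g

  pointOf-element : ∀ s → pointOf (element s) ≡ s
  pointOf-element (a , b) = cong₂ _,_ (proj₁ labels) (proj₂ labels)
    where labels = proj₂ (labels-realisable 0≢1 a b)

  coordinate-pointOf : ∀ g i → coordinate i (pointOf g) ≡ label i g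
  coordinate-pointOf g = labels-determined 0≢1 (cong proj₁ (pointOf-element (pointOf g)))
                                                  (cong proj₂ (pointOf-element (pointOf g)))

  coordinates-bijective : ∀ i j → i ≢ j → Bijective _≡_ _≡_ (λ s → coordinate i s , coordinate j s)
  coordinates-bijective i j i≢j = injective , surjective
    where
    injective : ∀ {s s′} → (coordinate i s , coordinate j s) ≡ (coordinate i s′ , coordinate j s′) → s ≡ s′
    injective {s} {s′} e = begin
      s                      ≡⟨ pointOf-element s ⟨
      pointOf (element s)    ≡⟨ cong₂ _,_ (same zero) (same (suc zero)) ⟩
      pointOf (element s′)   ≡⟨ pointOf-element s′ ⟩
      s′                     ∎
      where
      open ≡-Reasoning
      same = labels-determined i≢j (cong proj₁ e) (cong proj₂ e)
    surjective : ∀ c → ∃ λ s → ∀ {s′} → s′ ≡ s → (coordinate i s′ , coordinate j s′) ≡ c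
    surjective (a , b) = pointOf g , λ { refl → cong₂ _,_ (trans (coordinate-pointOf g i) lᵢ)
                                                          (trans (coordinate-pointOf g j) lⱼ) }
      where
      g = proj₁ (labels-realisable i≢j a b)
      lᵢ = proj₁ (proj₂ (labels-realisable i≢j a b))
      lⱼ = proj₂ (proj₂ (labels-realisable i≢j a b))

  array : OA (suc (suc k)) n
  array .S     = Point
  array .X _   = Fin n
  array .π     = coordinate
  array .size _ = ↔-refl
  array .pairs = coordinates-bijective

  cosetAction : Carrier → ∀ i → Fin n ↔ Fin n
  cosetAction x i = mk↔ₛ′ (λ t → label i (x ∙ rep i t)) (λ t → label i (x ⁻¹ ∙ rep i t))
                          (cancel x (\\-leftDividesˡ x)) (cancel (x ⁻¹) (\\-leftDividesʳ x))
    where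
    cancel : ∀ y {y′} → (∀ z → y ∙ (y′ ∙ z) ≈ z) →
             ∀ t → label i (y ∙ rep i (label i (y′ ∙ rep i t))) ≡ t
    cancel y {y′} yy′≈1 t = trans (label-∙-rep i y _) (trans (label-cong i (yy′≈1 (rep i t))) (label-rep i t))

  translate : Carrier → Autotopy array
  translate x = isotopy⇒autotopy (mkIsotopy (λ s → pointOf (x ∙ element s)) (cosetAction x) comm)
    where
    comm : ∀ i s → coordinate i (pointOf (x ∙ element s)) ≡ label i (x ∙ rep i (coordinate i s))
    comm i s = trans (coordinate-pointOf _ i) (sym (label-∙-rep i x (element s)))

  translate-transitive : Transitive array
  translate-transitive s t = translate (element t ∙ element s ⁻¹) , λ l → sym (begin
    label l ((element t ∙ element s ⁻¹) ∙ rep l (coordinate l s))  ≡⟨ label-∙-rep l _ (element s) ⟩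
    label l ((element t ∙ element s ⁻¹) ∙ element s)               ≡⟨ label-cong l (//-rightDividesˡ (element s) (element t)) ⟩
    coordinate l t                                                 ∎)
    where open ≡-Reasoning

  cosetArray : TOA (suc (suc k)) n
  cosetArray = array , translate-transitive

  origin : Point
  origin = pointOf ε

  -- The array is written proj₁ cosetArray from here on so that these types agree
  -- syntactically with stabiliserPacket cosetArray: converting between the two forms
  -- unfolds the autotopy group and makes type checking very slow.
  translate-hom : IsGroupHomomorphism rawGroup (Group.rawGroup (autotopyGroup (proj₁ cosetArray))) translate
  translate-hom = record
    { isMonoidHomomorphism = record
      { isMagmaHomomorphism = record
        { isRelHomomorphism = record { cong = λ x≈y i t → label-cong i (∙-congʳ x≈y) }
        ; homo = λ x y i t → trans (label-cong i (assoc x y _)) (sym (label-∙-rep i x _))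
        }
      ; ε-homo = λ i t → trans (label-cong i (identityˡ _)) (label-rep i t)
      }
    ; ⁻¹-homo = λ _ _ _ → refl
    }

  translate-fixes⇔ : ∀ i h →
    H i h ⇔ StabiliserPacket.Stabiliser (proj₁ cosetArray) (proj₂ cosetArray) origin i (translate h)
  translate-fixes⇔ i h = fixes⇔label≡label-ε ⇔-∘ H⇔label≡label-ε i
    where
    base : coordinate i origin ≡ label i ε
    base = coordinate-pointOf ε i
    moved : to (σᵢ (translate h) i) (coordinate i origin) ≡ label i h
    moved = trans (label-∙-rep i h _) (trans (label-∙ˡ i h base) (label-cong i (identityʳ h)))
    fixes⇔label≡label-ε :
      (label i h ≡ label i ε) ⇔ StabiliserPacket.Stabiliser (proj₁ cosetArray) (proj₂ cosetArray) origin i (translate h)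
    fixes⇔label≡label-ε = mk⇔ (λ e → trans moved (trans e (sym base))) (λ e → trans (sym moved) (trans e base))

  translate-admissible : Admissible P (StabiliserPacket.packet (proj₁ cosetArray) (proj₂ cosetArray) origin)
  translate-admissible =
    PacketMorphisms.mkAdmissible P (StabiliserPacket.packet (proj₁ cosetArray) (proj₂ cosetArray) origin)
      translate translate-hom translate-fixes⇔

  stabiliserPacket≃packet : ∀ s → GPEquiv (StabiliserPacket.packet (proj₁ cosetArray) (proj₂ cosetArray) s) P
  stabiliserPacket≃packet s =
      StabiliserPacket.packet (proj₁ cosetArray) (proj₂ cosetArray) origin
    , isotopy⇒admissible {A = proj₁ cosetArray} {B = proj₁ cosetArray}
        (proj₂ cosetArray) (proj₂ cosetArray) isotopy-refl s origin
    , translate-admissible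

admissible⇒isotopy : {P Q : GroupPacket (suc (suc k)) n} → Admissible P Q →
                     Isotopy (CosetArray.array P) (CosetArray.array Q)
admissible⇒isotopy {P = P} {Q} adm = mkIsotopy (λ s → Q.pointOf (α (P.element s))) inducedMap comm
  where
  module P = CosetArray P
  module Q = CosetArray Q
  open Admissible adm using (α; hom; maps; inj)
  open PacketMorphisms.InducedMaps P Q α hom maps inj using (inducedMap; inducedMap-label)
  comm : ∀ i s → Q.coordinate i (Q.pointOf (α (P.element s))) ≡ to (inducedMap i) (P.coordinate i s)
  comm i s = trans (Q.coordinate-pointOf _ i) (inducedMap-label i (P.element s))

cosetArray-of-stabiliserPacket : (A : OA (suc (suc k)) n) (transitive : Transitive A) (s₀ : S A) →
  Isotopy A (CosetArray.array (StabiliserPacket.packet A transitive s₀))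
cosetArray-of-stabiliserPacket A transitive s₀ = mkIsotopy (λ s → pointOf (moving s)) (size A) comm
  where
  open CosetArray (StabiliserPacket.packet A transitive s₀) using (coordinate; pointOf; coordinate-pointOf)
  moving : S A → Autotopy A
  moving s = proj₁ (transitive s₀ s)
  comm : ∀ i s → coordinate i (pointOf (moving s)) ≡ to (size A i) (π A i s)
  comm i s = trans (coordinate-pointOf (moving s) i) (cong (to (size A i)) (sym (proj₂ (transitive s₀ s) i)))

basePoint : (A : OA (suc (suc k)) (suc n)) → S A
basePoint A = proj₁ (pair-surjective A 0≢1 (from (size A zero) zero) (from (size A (suc zero)) zero))

stabiliserPacket : TOA (suc (suc k)) (suc n) → GroupPacket (suc (suc k)) (suc n)
stabiliserPacket (A , transitive) = StabiliserPacket.packet A transitive (basePoint A)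

stabiliserPacket-cong : (A B : TOA (suc (suc k)) (suc n)) → IsotopicT A B →
                        GPEquiv (stabiliserPacket A) (stabiliserPacket B)
stabiliserPacket-cong (A , trA) (B , trB) ι =
  stabiliserPacket (B , trB) , isotopy⇒admissible trA trB ι _ _ , isotopy⇒admissible trB trB isotopy-refl _ _

cosetArray-cong : (P P′ : GroupPacket (suc (suc k)) (suc n)) → GPEquiv P P′ →
                  IsotopicT (CosetArray.cosetArray P) (CosetArray.cosetArray P′)
cosetArray-cong P P′ (Q , α , α′) =
  isotopy-trans (admissible⇒isotopy {P = P} {Q} α) (isotopy-sym (admissible⇒isotopy {P = P′} {Q} α′))

cosetArray∘stabiliserPacket : (A : TOA (suc (suc k)) (suc n)) →
                              IsotopicT (CosetArray.cosetArray (stabiliserPacket A)) A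
cosetArray∘stabiliserPacket (A , transitive) = isotopy-sym (cosetArray-of-stabiliserPacket A transitive (basePoint A))

stabiliserPacket∘cosetArray : (P : GroupPacket (suc (suc k)) (suc n)) →
                              GPEquiv (stabiliserPacket (CosetArray.cosetArray P)) P
stabiliserPacket∘cosetArray P = CosetArray.stabiliserPacket≃packet P (basePoint (proj₁ (CosetArray.cosetArray P)))

Correspondence : ℕ → ℕ → Set₁
Correspondence m n =
  Σ (TOA m n → GroupPacket m n) λ Φ →
  Σ (GroupPacket m n → TOA m n) λ Ψ →
    ((A B : TOA m n) → IsotopicT A B → GPEquiv (Φ A) (Φ B)) ×
    ((P P' : GroupPacket m n) → GPEquiv P P' → IsotopicT (Ψ P) (Ψ P')) ×
    ((A : TOA m n) → IsotopicT (Ψ (Φ A)) A) ×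
    ((P : GroupPacket m n) → GPEquiv (Φ (Ψ P)) P)

correspondence : ∀ k n → Correspondence (suc (suc k)) (suc n)
correspondence k n =
    stabiliserPacket
  , CosetArray.cosetArray
  , stabiliserPacket-cong
  , cosetArray-cong
  , cosetArray∘stabiliserPacket
  , stabiliserPacket∘cosetArray

theorem3p17 : (q n : ℕ) → 1 ≤ q → 1 ≤ n →
    Σ (TOA (q + 2) n → GroupPacket (q + 2) n) λ Φ →
    Σ (GroupPacket (q + 2) n → TOA (q + 2) n) λ Ψ →
      ((A B : TOA (q + 2) n) → IsotopicT A B → GPEquiv (Φ A) (Φ B)) ×
      ((P P' : GroupPacket (q + 2) n) → GPEquiv P P' → IsotopicT (Ψ P) (Ψ P')) ×
      ((A : TOA (q + 2) n) → IsotopicT (Ψ (Φ A)) A) ×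
      ((P : GroupPacket (q + 2) n) → GPEquiv (Φ (Ψ P)) P)
-- Two coordinates suffice, so 1 ≤ q is not used; 1 ≤ n provides the base point.
theorem3p17 q zero    _ ()
theorem3p17 q (suc n) _ _ = subst (λ m → Correspondence m (suc n)) (+-comm 2 q) (correspondence q n)
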